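{- For every integer $h\ge 2$ there exists an asymptotic basis $A$ for $\mathbb{N}_0$ of order $h$ (with $0\in A$) which has no essentialities, finite or infinite.
   Context: All sets are subsets of $\mathbb{N}_0=\{0,1,2,\dots\}$. For $A\subseteq\mathbb{N}_0$ with $0\in A$ and an integer $h\ge 1$, $hA=\{a_1+\cdots+a_h : a_1,\dots,a_h\in A\}$. A set $B\subseteq\mathbb{N}_0$ is an asymptotic basis of order $h$ if all but finitely many non-negative integers can be written as a sum of at most $h$ elements of $B$ (for $0\in B$ this says $\mathbb{N}_0\setminus hB$ is finite); $B$ is an asymptotic basis (of some order) if it is one of order $h$ for some $h$. If $A$ is an asymptotic basis, an essentiality of $A$ is a subset $P\subseteq A$ such that $A\setminus P$ is not an asymptotic basis of any order, and $P$ is minimal with respect to inclusion among subsets of $A$ with this property. -}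

module Defs where

open import Data.Nat using (ℕ; _≤_; _≥_)
open import Data.Bool using (Bool; true; false; _∧_; not)
open import Data.List using (List; length)
open import Data.Nat.ListAction using (sum)
open import Data.List.Relation.Unary.All using (All)
open import Data.Product using (∃; Σ; _×_; _,_)
open import Relation.Nullary using (¬_)
open import Relation.Binary.PropositionalEquality using (_≡_)

NSet : Set
NSet = ℕ → Bool

_∈ₛ_ : ℕ → NSet → Set
n ∈ₛ B = B n ≡ true

_⊆ₛ_ : NSet → NSet → Set
P ⊆ₛ Q = ∀ n → n ∈ₛ P → n ∈ₛ Q

_∖ₛ_ : NSet → NSet → NSet
(A ∖ₛ P) n = A n ∧ not (P n)

SumOfAtMost : ℕ → NSet → ℕ → Set
SumOfAtMost h B n =
  Σ (List ℕ) λ xs → (length xs ≤ h) × All (λ x → x ∈ₛ B) xs × (sum xs ≡ n)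

IsAsymptoticBasisOfOrder : ℕ → NSet → Set
IsAsymptoticBasisOfOrder h B = ∃ λ N → ∀ n → n ≥ N → SumOfAtMost h B n

IsAsymptoticBasis : NSet → Set
IsAsymptoticBasis B = ∃ λ h → (1 ≤ h) × IsAsymptoticBasisOfOrder h B

IsEssentiality : NSet → NSet → Set
IsEssentiality A P =
  (P ⊆ₛ A)
  × ¬ IsAsymptoticBasis (A ∖ₛ P)
  × (∀ Q → Q ⊆ₛ P → ¬ IsAsymptoticBasis (A ∖ₛ Q) → P ⊆ₛ Q)

module Submission where

-- Call a set B "sparse in multiples" if for every g ≥ 2 the
-- multiples of g in B have arbitrarily long multiplicative gaps [X, K·X).
-- The heart of the proof is a general fact: if B is sparse in multiples and
-- not an asymptotic basis, then B ∪ {p} is not an asymptotic basis either.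
-- Indeed, were B ∪ {p} a basis, then
--   * no g ≥ 2 divides all of B (the number k·X inside a gap of the
--     multiples of g cannot be a sum of k elements of B ∪ {p});
--   * hence, by a Euclidean descent on Bézout combinations, B represents two
--     consecutive numbers u, u + 1 with a bounded number of summands;
--   * and then every large number is a sum of boundedly many elements of B,
--     so B would be a basis after all.
-- Consequently a basis A all of whose subsets are sparse in multiples has no
-- essentiality: removing an essentiality P and putting back one p ∈ P would
-- have to give a basis by minimality of P.
--
-- The set A is built from blocks [Z k, Z (k+1)), where
-- Z (k+1) = (k+1)·Z k + (k+1)!: inside block k it contains the final
-- interval [(k+1)·Z k, Z (k+1)) of length (k+1)! and the numbers ≡ 1
-- modulo k!.  Every n in block k+1 is an element of the final interval of
-- block k plus a number ≡ 1 modulo (k+1)!, so A has order 2; and a multiple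
-- of g ≥ 2 in A lies in a block below g or in a final interval, leaving
-- the gaps [Z j, (j+1)·Z j) free for j ≥ g.

open import Defs
open import Data.Nat
open import Data.Nat.Properties
open import Data.Nat.DivMod using (_/_; _%_; m≡m%n+[m/n]*n; m%n<n; m*n/n≡m; m/n≤m; /-monoˡ-≤)
open import Data.Nat.Divisibility
open import Data.Nat.GCD using (gcd; gcd-GCD; gcd[m,n]∣m; gcd[m,n]∣n; gcd[m,n]≢0; module Bézout)
open import Data.Nat.Induction using (<-rec)
open import Data.Nat.ListAction using (sum)
open import Data.Nat.ListAction.Properties using (sum-++)
open import Data.Nat.Tactic.RingSolver using (solve-∀)
open import Data.Bool using (true; false; _∧_; _∨_; not)
open import Data.Bool.Properties using (T-≡; ∧-identityʳ; ∧-zeroʳ)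
open import Data.List using ([]; _∷_; length; _++_)
open import Data.List.Properties using (length-++)
open import Data.List.Relation.Unary.All as All using (All; []; _∷_)
open import Data.List.Relation.Unary.All.Properties using (++⁺)
open import Data.Product using (Σ; _×_; _,_; proj₁; proj₂)
open import Data.Sum using (_⊎_; inj₁; inj₂)
open import Data.Empty using (⊥; ⊥-elim)
open import Function.Bundles using (Equivalence)
open import Relation.Nullary using (¬_; Dec; yes; no)
open import Relation.Nullary.Decidable using (_⊎-dec_; isYes; toWitness; fromWitness; decidable-stable)
open import Relation.Binary.PropositionalEquality

variable
  B B′ : NSet
  c c′ x y : ℕ

-- 1.  Sums of boundedly many elements of a set

sum-zero : SumOfAtMost c B 0
sum-zero = [] , z≤n , [] , refl

sum-one : x ∈ₛ B → SumOfAtMost 1 B x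
sum-one {x} x∈B = x ∷ [] , ≤-refl , x∈B ∷ [] , +-identityʳ x

sum-add : SumOfAtMost c B x → SumOfAtMost c′ B y → SumOfAtMost (c + c′) B (x + y)
sum-add (xs , xs≤c , xs∈B , refl) (ys , ys≤c′ , ys∈B , refl) =
  xs ++ ys , subst (_≤ _) (sym (length-++ xs)) (+-mono-≤ xs≤c ys≤c′) , ++⁺ xs∈B ys∈B , sum-++ xs ys

sum-weaken : c ≤ c′ → SumOfAtMost c B x → SumOfAtMost c′ B x
sum-weaken c≤c′ (xs , xs≤c , xs∈B , xs≡x) = xs , ≤-trans xs≤c c≤c′ , xs∈B , xs≡x

sum-mono-set : B ⊆ₛ B′ → SumOfAtMost c B x → SumOfAtMost c B′ x
sum-mono-set B⊆B′ (xs , xs≤c , xs∈B , xs≡x) = xs , xs≤c , All.map (B⊆B′ _) xs∈B , xs≡x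

sum-scale : ∀ t → SumOfAtMost c B x → SumOfAtMost (t * c) B (t * x)
sum-scale zero    _ = sum-zero
sum-scale (suc t) r = sum-add r (sum-scale t r)

summands≤sum : ∀ xs → All (_≤ sum xs) xs
summands≤sum []       = []
summands≤sum (x ∷ xs) =
  m≤m+n x (sum xs) ∷ All.map (λ x′≤ → ≤-trans x′≤ (m≤n+m (sum xs) x)) (summands≤sum xs)

sum+length≤length*bound : ∀ {X} xs → All (_< X) xs → sum xs + length xs ≤ length xs * X
sum+length≤length*bound []       []             = z≤n
sum+length≤length*bound {X} (x ∷ xs) (x<X ∷ xs<X) =
  subst (_≤ X + length xs * X) (regroup x (sum xs) (length xs))
    (+-mono-≤ x<X (sum+length≤length*bound xs xs<X))
  where
  regroup : ∀ a b n → suc a + (b + n) ≡ a + b + suc n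
  regroup = solve-∀

sum<count*bound : ∀ {X k} xs → 1 ≤ k → 1 ≤ X → length xs ≤ k → All (_< X) xs → sum xs < k * X
sum<count*bound []       1≤k 1≤X _ _ = *-mono-≤ 1≤k 1≤X
sum<count*bound {X} {k} xs@(_ ∷ _) _ _ xs≤k xs<X = begin-strict
  sum xs                 <⟨ m<m+n (sum xs) (s≤s z≤n) ⟩
  sum xs + length xs     ≤⟨ sum+length≤length*bound xs xs<X ⟩
  length xs * X          ≤⟨ *-monoˡ-≤ X xs≤k ⟩
  k * X                  ∎
  where open ≤-Reasoning

-- If B represents u and u + 1 with c summands, it represents every v ≥ u²
-- with v·c summands: write v = (t - r)·u + r·(u + 1) for t = v / u, r = v % u.
consecutive⇒large : ∀ u → SumOfAtMost c B u → SumOfAtMost c B (suc u) →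
                    ∀ v → u * u ≤ v → SumOfAtMost (v * c) B v
consecutive⇒large zero _ r₁ v _ = subst (SumOfAtMost _ _) (*-identityʳ v) (sum-scale v r₁)
consecutive⇒large {c} u@(suc _) rᵤ rᵤ₊₁ v u*u≤v =
  sum-weaken count≤ (subst (SumOfAtMost _ _) combination≡v
    (sum-add (sum-scale (t ∸ r) rᵤ) (sum-scale r rᵤ₊₁)))
  where
  t = v / u
  r = v % u
  r≤t : r ≤ t
  r≤t = <⇒≤ (<-≤-trans (m%n<n v u) (subst (_≤ t) (m*n/n≡m u u) (/-monoˡ-≤ u u*u≤v)))
  combination≡v : (t ∸ r) * u + r * suc u ≡ v
  combination≡v = begin
    (t ∸ r) * u + r * suc u   ≡⟨ regroup (t ∸ r) r u ⟩
    ((t ∸ r) + r) * u + r     ≡⟨ cong (λ s → s * u + r) (m∸n+n≡m r≤t) ⟩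
    t * u + r                 ≡⟨ +-comm (t * u) r ⟩
    r + t * u                 ≡⟨ m≡m%n+[m/n]*n v u ⟨
    v                         ∎
    where
    open ≡-Reasoning
    regroup : ∀ a b w → a * w + b * suc w ≡ (a + b) * w + b
    regroup = solve-∀
  count≤ : (t ∸ r) * c + r * c ≤ v * c
  count≤ = subst (_≤ v * c) (*-distribʳ-+ c (t ∸ r) r)
                (*-monoˡ-≤ c (subst (_≤ v) (sym (m∸n+n≡m r≤t)) (m/n≤m v u)))

basis-mono : B ⊆ₛ B′ → IsAsymptoticBasis B → IsAsymptoticBasis B′
basis-mono B⊆B′ (h , 1≤h , N , represent) =
  h , 1≤h , N , λ n n≥N → sum-mono-set B⊆B′ (represent n n≥N)

basisOfOrder-mono : ∀ {h h′} → h ≤ h′ → IsAsymptoticBasisOfOrder h B → IsAsymptoticBasisOfOrder h′ B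
basisOfOrder-mono h≤h′ (N , represent) = N , λ n n≥N → sum-weaken h≤h′ (represent n n≥N)

-- 2.  Adding one point to a sparse non-basis does not create a basis

insert : ℕ → NSet → NSet
insert p B n = (n ≡ᵇ p) ∨ B n

∈-insert : ∀ {p} → x ∈ₛ insert p B → x ≡ p ⊎ x ∈ₛ B
∈-insert {x} {B} {p} x∈ with x ≡ᵇ p in x≡ᵇp
... | true  = inj₁ (≡ᵇ⇒≡ x p (Equivalence.from T-≡ x≡ᵇp))
... | false = inj₂ x∈

HasSparseMultiples : NSet → Set
HasSparseMultiples B =
  ∀ g → 2 ≤ g → ∀ K N → Σ ℕ λ X → N ≤ X × (∀ b → b ∈ₛ B → g ∣ b → b < X ⊎ K * X ≤ b)

sparse-⊆ : B ⊆ₛ B′ → HasSparseMultiples B′ → HasSparseMultiples B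
sparse-⊆ B⊆B′ sparse g 2≤g K N with sparse g 2≤g K N
... | X , N≤X , gap = X , N≤X , λ b b∈B → gap b (B⊆B′ b b∈B)

PairAtDistance : NSet → ℕ → Set
PairAtDistance B d = Σ ℕ λ c → Σ ℕ λ u → SumOfAtMost c B u × SumOfAtMost c B (u + d)

pair-element : x ∈ₛ B → PairAtDistance B x
pair-element x∈B = 1 , 0 , sum-zero , sum-one x∈B

-- Euclidean step: if d does not divide some b ∈ B, a Bézout combination of
-- the pair at distance d and of b yields a pair at distance gcd d b < d.
closerPair : ∀ {d b} → 1 ≤ d → b ∈ₛ B → ¬ d ∣ b → PairAtDistance B d →
             Σ ℕ λ g → 1 ≤ g × g < d × PairAtDistance B g
closerPair {B} {d} {b} 1≤d b∈B d∤b (c , u , rᵤ , rᵤ₊d) =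
  g , 1≤g , g<d , pair (Bézout.identity (gcd-GCD d b))
  where
  g = gcd d b
  d≢0 : d ≢ 0
  d≢0 refl = <⇒≱ 1≤d z≤n
  1≤g : 1 ≤ g
  1≤g = n≢0⇒n>0 (gcd[m,n]≢0 d b (inj₁ d≢0))
  g<d : g < d
  g<d = ≤∧≢⇒< (∣⇒≤ {{≢-nonZero d≢0}} (gcd[m,n]∣m d b))
               (λ g≡d → d∤b (subst (_∣ b) g≡d (gcd[m,n]∣n d b)))
  combine : ∀ s t → SumOfAtMost (s * c + t * 1) B (s * u + t * b)
  combine s t = sum-add (sum-scale s rᵤ) (sum-scale t (sum-one b∈B))
  shift : ∀ s t → SumOfAtMost (s * c + t * 1) B (s * (u + d))
  shift s t = sum-weaken (m≤m+n (s * c) (t * 1)) (sum-scale s rᵤ₊d)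
  regroup : ∀ a e f → a + (e + f) ≡ a + f + e
  regroup = solve-∀
  pair : Bézout.Identity g d b → PairAtDistance B g
  -- g + t·b = s·d: the pair (s·u + t·b, s·(u + d))
  pair (Bézout.+- s t g+tb≡sd) =
    _ , _ , combine s t , subst (SumOfAtMost _ B) s[u+d]≡ (shift s t)
    where
    open ≡-Reasoning
    s[u+d]≡ : s * (u + d) ≡ s * u + t * b + g
    s[u+d]≡ = begin
      s * (u + d)           ≡⟨ *-distribˡ-+ s u d ⟩
      s * u + s * d         ≡⟨ cong (s * u +_) g+tb≡sd ⟨
      s * u + (g + t * b)   ≡⟨ regroup (s * u) g (t * b) ⟩
      s * u + t * b + g     ∎
  -- g + s·d = t·b: the pair (s·(u + d), s·u + t·b)
  pair (Bézout.-+ s t g+sd≡tb) =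
    _ , _ , shift s t , subst (SumOfAtMost _ B) su+tb≡ (combine s t)
    where
    open ≡-Reasoning
    su+tb≡ : s * u + t * b ≡ s * (u + d) + g
    su+tb≡ = begin
      s * u + t * b         ≡⟨ cong (s * u +_) g+sd≡tb ⟨
      s * u + (g + s * d)   ≡⟨ regroup (s * u) g (s * d) ⟩
      s * u + s * d + g     ≡⟨ cong (_+ g) (*-distribˡ-+ s u d) ⟨
      s * (u + d) + g       ∎

descent : (PairAtDistance B 1 → ⊥) → (∀ g → 2 ≤ g → ¬ (∀ b → b ∈ₛ B → g ∣ b)) →
          ∀ d → 1 ≤ d → PairAtDistance B d → ⊥
descent {B} noConsecutive noCommonDivisor = <-rec Goal step
  where
  Goal : ℕ → Set
  Goal d = 1 ≤ d → PairAtDistance B d → ⊥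
  step : ∀ d → (∀ {d′} → d′ < d → Goal d′) → Goal d
  step zero          _       ()  _
  step (suc zero)    _       _   pair = noConsecutive pair
  step d@(suc (suc _)) smaller 1≤d pair = noCommonDivisor d (s≤s (s≤s z≤n)) d∣B
    where
    d∣B : ∀ b → b ∈ₛ B → d ∣ b
    d∣B b b∈B = decidable-stable (d ∣? b) λ d∤b →
      let (g , 1≤g , g<d , closer) = closerPair 1≤d b∈B d∤b pair in smaller g<d 1≤g closer

module OnePointExtension (B : NSet) (p k : ℕ) (1≤k : 1 ≤ k) (N : ℕ)
  (extended : ∀ n → n ≥ N → SumOfAtMost k (insert p B) n) where

  splitOff : ∀ {c n} → SumOfAtMost c (insert p B) n →
             Σ ℕ λ j → Σ ℕ λ m → j ≤ c × SumOfAtMost c B m × m + j * p ≡ n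
  splitOff ([] , _ , [] , refl) = 0 , 0 , z≤n , sum-zero , refl
  splitOff {suc c} (x ∷ xs , s≤s xs≤c , x∈ ∷ xs∈ , refl)
    with splitOff (xs , xs≤c , xs∈ , refl) | ∈-insert {B = B} x∈
  ... | j , m , j≤c , rₘ , m+jp≡ | inj₁ refl =
    suc j , m , s≤s j≤c , sum-weaken (n≤1+n c) rₘ ,
    trans (regroup m x (j * x)) (cong (x +_) m+jp≡)
    where
    regroup : ∀ a e f → a + (e + f) ≡ e + (a + f)
    regroup = solve-∀
  ... | j , m , j≤c , rₘ , m+jp≡ | inj₂ x∈B =
    j , x + m , m≤n⇒m≤1+n j≤c , sum-add (sum-one x∈B) rₘ ,
    trans (+-assoc x m (j * p)) (cong (x +_) m+jp≡)

  -- Two consecutive representable numbers make B itself a basis: the part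
  -- of n outside B is j·p for some j ≤ k, and j·p + u² is represented by B.
  pair⇒basis : PairAtDistance B 1 → IsAsymptoticBasis B
  pair⇒basis (c , u , rᵤ , rᵤ₊₁) =
    k + (k * p + u * u) * c , ≤-trans 1≤k (m≤m+n k _) , N + u * u , represent
    where
    W = u * u
    represent : ∀ n → n ≥ N + W → SumOfAtMost (k + (k * p + W) * c) B n
    represent n n≥N+W with splitOff (extended (n ∸ W) (m+n≤o⇒m≤o∸n N n≥N+W))
    ... | j , m , j≤k , rₘ , m+jp≡ =
      sum-weaken (+-monoʳ-≤ k (*-monoˡ-≤ c (+-monoˡ-≤ W (*-monoˡ-≤ p j≤k))))
        (subst (SumOfAtMost _ B) m+[jp+W]≡n (sum-add rₘ large))
      where
      large : SumOfAtMost ((j * p + W) * c) B (j * p + W)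
      large = consecutive⇒large u rᵤ (subst (SumOfAtMost c B) (+-comm u 1) rᵤ₊₁)
                (j * p + W) (m≤n+m W (j * p))
      m+[jp+W]≡n : m + (j * p + W) ≡ n
      m+[jp+W]≡n = begin
        m + (j * p + W)   ≡⟨ +-assoc m (j * p) W ⟨
        m + j * p + W     ≡⟨ cong (_+ W) m+jp≡ ⟩
        n ∸ W + W         ≡⟨ m∸n+n≡m (≤-trans (m≤n+m W N) n≥N+W) ⟩
        n                 ∎
        where open ≡-Reasoning

  -- If g ≥ 2 divided all of B, the number k·X, taken inside a gap
  -- [X, (k+1)·X) of the multiples of g with X > p, would be a sum of at
  -- most k summands all below X.
  noCommonDivisor : HasSparseMultiples B → ∀ g → 2 ≤ g → ¬ (∀ b → b ∈ₛ B → g ∣ b)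
  noCommonDivisor sparse g 2≤g g∣B with sparse g 2≤g (suc k) (N + suc p)
  ... | X , N+p<X , gap with extended (k * X) N≤kX
    where
    N≤kX : N ≤ k * X
    N≤kX = ≤-trans (≤-trans (m≤m+n N (suc p)) N+p<X) (m≤n*m X k {{>-nonZero 1≤k}})
  ... | xs , xs≤k , xs∈ , xs≡kX =
    <-irrefl xs≡kX (sum<count*bound xs 1≤k 1≤X xs≤k
      (All.zipWith (λ (y∈ , y≤) → below y∈ (subst (_ ≤_) xs≡kX y≤)) (xs∈ , summands≤sum xs)))
    where
    p<X : p < X
    p<X = ≤-trans (m≤n+m (suc p) N) N+p<X
    1≤X : 1 ≤ X
    1≤X = ≤-trans (s≤s z≤n) p<X
    below : ∀ {y} → y ∈ₛ insert p B → y ≤ k * X → y < X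
    below y∈ y≤kX with ∈-insert {B = B} y∈
    ... | inj₁ refl = p<X
    ... | inj₂ y∈B with gap _ y∈B (g∣B _ y∈B)
    ...   | inj₁ y<X      = y<X
    ...   | inj₂ [k+1]X≤y = ⊥-elim (<⇒≱ (+-monoˡ-≤ (k * X) 1≤X) (≤-trans [k+1]X≤y y≤kX))

  -- A sparse non-basis B contradicts B ∪ {p} being a basis: every element
  -- of B is even (an odd one gives a pair at odd distance, which descends
  -- to a consecutive pair), but 2 cannot divide all of B.
  impossible : HasSparseMultiples B → ¬ IsAsymptoticBasis B → ⊥
  impossible sparse notBasis = noCommonDivisor sparse 2 ≤-refl 2∣B
    where
    positive : ∀ {b} → ¬ 2 ∣ b → 1 ≤ b
    positive {zero}  2∤0 = ⊥-elim (2∤0 (divides 0 refl))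
    positive {suc _} _   = s≤s z≤n
    2∣B : ∀ b → b ∈ₛ B → 2 ∣ b
    2∣B b b∈B = decidable-stable (2 ∣? b) λ 2∤b →
      descent (λ pair → notBasis (pair⇒basis pair)) (noCommonDivisor sparse)
              b (positive 2∤b) (pair-element b∈B)

extension-not-basis : ∀ p → HasSparseMultiples B → ¬ IsAsymptoticBasis B →
                      ¬ IsAsymptoticBasis (insert p B)
extension-not-basis {B} p sparse notBasis (k , 1≤k , N , extended) =
  OnePointExtension.impossible B p k 1≤k N extended sparse notBasis

-- 3.  Essentialities reduce to one-point extensions

❴_❵ : ℕ → NSet
❴ p ❵ n = n ≡ᵇ p

∖-⊆ : ∀ A P → (A ∖ₛ P) ⊆ₛ A
∖-⊆ A P n n∈ with A n
... | true  = refl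
... | false = n∈

∈-∖ : ∀ {A P n} → n ∈ₛ A → ¬ n ∈ₛ P → n ∈ₛ (A ∖ₛ P)
∈-∖ {A} {P} {n} n∈A n∉P with P n
... | true  = ⊥-elim (n∉P refl)
... | false = trans (∧-identityʳ (A n)) n∈A

p∈❴p❵ : ∀ p → p ∈ₛ ❴ p ❵
p∈❴p❵ p = Equivalence.to T-≡ (≡⇒≡ᵇ p p refl)

∉-∖❴❵ : ∀ P p → ¬ p ∈ₛ (P ∖ₛ ❴ p ❵)
∉-∖❴❵ P p p∈ with () ← trans (sym p∈) (trans (cong (λ b → P p ∧ not b) (p∈❴p❵ p)) (∧-zeroʳ (P p)))

∖-all-but-one : ∀ A P p → (A ∖ₛ (P ∖ₛ ❴ p ❵)) ⊆ₛ insert p (A ∖ₛ P)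
∖-all-but-one A P p n n∈ with n ≡ᵇ p
... | true = refl
... | false with A n | P n
...   | true  | false = refl
...   | true  | true  = n∈
...   | false | _     = n∈

-- If no non-basis subset of the basis A becomes a basis by adding one point,
-- then A has no essentiality: by minimality, removing P ∖ {p} for p ∈ P
-- would leave a basis, so P is empty, and then A ∖ P = A is a basis.
noEssentiality : ∀ A → IsAsymptoticBasis A →
  (∀ B p → B ⊆ₛ A → ¬ IsAsymptoticBasis B → ¬ IsAsymptoticBasis (insert p B)) →
  ∀ P → ¬ IsEssentiality A P
noEssentiality A basis noExtension P (_ , notBasis , minimal) =
  notBasis (basis-mono (λ n n∈A → ∈-∖ {A} {P} n∈A (P-empty n)) basis)
  where
  P-empty : ∀ p → ¬ p ∈ₛ P
  P-empty p p∈P = ∉-∖❴❵ P p (minimal (P ∖ₛ ❴ p ❵) (∖-⊆ P ❴ p ❵) smallerNotBasis p p∈P)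
    where
    smallerNotBasis : ¬ IsAsymptoticBasis (A ∖ₛ (P ∖ₛ ❴ p ❵))
    smallerNotBasis b =
      noExtension (A ∖ₛ P) p (∖-⊆ A P) notBasis (basis-mono (∖-all-but-one A P p) b)

-- 4.  The basis A

-- Block k is [blockStart k, blockStart (k+1)); its last (k+1)! elements,
-- from fullStart k on, form its "full part", which lies entirely in A.
blockStart : ℕ → ℕ
blockStart zero    = 0
blockStart (suc k) = suc k * blockStart k + (suc k) !

fullStart : ℕ → ℕ
fullStart k = suc k * blockStart k

blockStart≤fullStart : ∀ k → blockStart k ≤ fullStart k
blockStart≤fullStart k = m≤m+n (blockStart k) (k * blockStart k)

blockStart-step : ∀ k → blockStart k < blockStart (suc k)
blockStart-step k = ≤-<-trans (blockStart≤fullStart k) (m<m+n (fullStart k) (1≤n! (suc k)))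

blockStart-mono-< : ∀ {i k} → i < k → blockStart i < blockStart k
blockStart-mono-< {i} {suc k} (s≤s i≤k) with m≤n⇒m<n∨m≡n i≤k
... | inj₁ i<k = <-trans (blockStart-mono-< i<k) (blockStart-step k)
... | inj₂ refl = blockStart-step k

blockStart-mono : ∀ {i k} → i ≤ k → blockStart i ≤ blockStart k
blockStart-mono i≤k with m≤n⇒m<n∨m≡n i≤k
... | inj₁ i<k = <⇒≤ (blockStart-mono-< i<k)
... | inj₂ refl = ≤-refl

blockStart-reflects-< : ∀ {i k} → blockStart i < blockStart k → i < k
blockStart-reflects-< {i} {k} Zi<Zk with i <? k
... | yes i<k = i<k
... | no  i≮k = ⊥-elim (<⇒≱ Zi<Zk (blockStart-mono (≮⇒≥ i≮k)))

n≤blockStart : ∀ n → n ≤ blockStart n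
n≤blockStart zero    = z≤n
n≤blockStart (suc n) = ≤-<-trans (n≤blockStart n) (blockStart-step n)

fullStart-mono : ∀ {i k} → i ≤ k → fullStart i ≤ fullStart k
fullStart-mono i≤k = *-mono-≤ (s≤s i≤k) (blockStart-mono i≤k)

level : ℕ → ℕ
level zero = 0
level (suc n) with blockStart (suc (level n)) ≤? suc n
... | yes _ = suc (level n)
... | no  _ = level n

level-bounds : ∀ n → blockStart (level n) ≤ n × n < blockStart (suc (level n))
level-bounds zero = z≤n , s≤s z≤n
level-bounds (suc n) with blockStart (suc (level n)) ≤? suc n
... | yes entered =
  entered , <-≤-trans (s≤s (proj₂ (level-bounds n))) (blockStart-step (suc (level n)))
... | no  stayed  = m≤n⇒m≤1+n (proj₁ (level-bounds n)) , ≰⇒> stayed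

level-ge : ∀ {k n} → blockStart k ≤ n → k ≤ level n
level-ge Zk≤n = s≤s⁻¹ (blockStart-reflects-< (≤-<-trans Zk≤n (proj₂ (level-bounds _))))

level-lt : ∀ {k n} → n < blockStart k → level n < k
level-lt n<Zk = blockStart-reflects-< (≤-<-trans (proj₁ (level-bounds _)) n<Zk)

below-level : ∀ {n j} → level n < j → n < blockStart j
below-level {n} lt = <-≤-trans (proj₂ (level-bounds n)) (blockStart-mono lt)

InA : ℕ → Set
InA a = fullStart (level a) ≤ a ⊎ (level a) ! ∣ a ∸ 1

InA? : ∀ a → Dec (InA a)
InA? a = fullStart (level a) ≤? a ⊎-dec (level a) ! ∣? a ∸ 1

-- A is kept opaque: outside this block membership is only accessed through
-- InA, which keeps the typechecker from unfolding `level` on open terms.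
opaque
  A : NSet
  A a = isYes (InA? a)

  ∈A⇒InA : ∀ {a} → a ∈ₛ A → InA a
  ∈A⇒InA {a} a∈A = toWitness {a? = InA? a} (Equivalence.from T-≡ a∈A)

  InA⇒∈A : ∀ {a} → InA a → a ∈ₛ A
  InA⇒∈A {a} inA = Equivalence.to T-≡ (fromWitness {a? = InA? a} inA)

fullPart⊆A : ∀ {k s} → fullStart k ≤ s → s < blockStart (suc k) → s ∈ₛ A
fullPart⊆A {k} {s} full≤s s<Z =
  InA⇒∈A {s} (inj₁ (subst (λ l → fullStart l ≤ s) (sym level≡k) full≤s))
  where
  level≡k : level s ≡ k
  level≡k = ≤-antisym (s≤s⁻¹ (level-lt s<Z)) (level-ge (≤-trans (blockStart≤fullStart k) full≤s))

progression⊆A : ∀ {k m} → level m ≤ k → k ! ∣ m ∸ 1 → m ∈ₛ A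
progression⊆A {m = m} level≤k k!∣ = InA⇒∈A {m} (inj₂ (∣-trans (m≤n⇒m!∣n! level≤k) k!∣))

-- n in block k+1 splits as s + m with s in the full part of block k and
-- m ≡ 1 mod (k+1)!, m ≤ n; both lie in A.
sumOfTwo : ∀ k n → blockStart (suc k) ≤ n → n < blockStart (suc (suc k)) → SumOfAtMost 2 A n
sumOfTwo k n Z≤n n<Z = subst (SumOfAtMost 2 A) s+m≡n (sum-add (sum-one s∈A) (sum-one m∈A))
  where
  F = (suc k) !
  instance
    F≢0 : NonZero F
    F≢0 = (suc k) !≢0
  D = n ∸ suc (fullStart k)
  s = fullStart k + D % F
  m = suc (D / F * F)
  s+m≡n : s + m ≡ n
  s+m≡n = begin
    fullStart k + D % F + suc (D / F * F)   ≡⟨ regroup (fullStart k) (D % F) (D / F * F) ⟩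
    suc (fullStart k) + (D % F + D / F * F) ≡⟨ cong (suc (fullStart k) +_) (m≡m%n+[m/n]*n D F) ⟨
    suc (fullStart k) + D                   ≡⟨ m+[n∸m]≡n fullStart<n ⟩
    n                                       ∎
    where
    open ≡-Reasoning
    regroup : ∀ a b e → a + b + suc e ≡ suc a + (b + e)
    regroup = solve-∀
    fullStart<n : fullStart k < n
    fullStart<n = ≤-trans (m<m+n (fullStart k) (1≤n! (suc k))) Z≤n
  s∈A : s ∈ₛ A
  s∈A = fullPart⊆A {k} (m≤m+n (fullStart k) (D % F)) (+-monoʳ-< (fullStart k) (m%n<n D F))
  m∈A : m ∈ₛ A
  m∈A = progression⊆A {suc k} (s≤s⁻¹ (level-lt {suc (suc k)} m<Z)) (n∣m*n (D / F))
    where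
    m<Z : m < blockStart (suc (suc k))
    m<Z = ≤-<-trans (subst (m ≤_) s+m≡n (m≤n+m m s)) n<Z

-- Every n ≥ 1 lies in some block k+1.
A-basis : IsAsymptoticBasisOfOrder 2 A
A-basis = 1 , represent
  where
  represent : ∀ n → n ≥ 1 → SumOfAtMost 2 A n
  represent n n≥1 with level n | level-bounds n | level-ge {1} n≥1
  ... | suc k | Z≤n , n<Z | _ = sumOfTwo k n Z≤n n<Z

n∣n! : ∀ {n} → 1 ≤ n → n ∣ n !
n∣n! {suc n} _ = m∣m*n (n !)

progression-coprime : ∀ {g a} → 2 ≤ g → g ≤ level a → (level a) ! ∣ a ∸ 1 → ¬ g ∣ a
progression-coprime {a = zero}   2≤g g≤0 _ _ = <⇒≱ 2≤g (≤-trans g≤0 z≤n)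
progression-coprime {g} {suc a} 2≤g g≤level level!∣a g∣1+a = <⇒≱ 2≤g (≤-reflexive (∣1⇒≡1 g∣1))
  where
  g∣a : g ∣ a
  g∣a = ∣-trans (∣-trans (n∣n! (≤-trans (s≤s z≤n) 2≤g)) (m≤n⇒m!∣n! g≤level)) level!∣a
  g∣1 : g ∣ 1
  g∣1 = ∣m+n∣m⇒∣n (subst (g ∣_) (+-comm 1 a) g∣1+a) g∣a

-- With j = K + g + N and X = blockStart j: multiples of g in the full
-- parts lie below X (blocks < j) or beyond fullStart j = (j+1)·X ≥ K·X, and
-- multiples of g in the progressions lie in blocks < g ≤ j.
A-sparse : HasSparseMultiples A
A-sparse g 2≤g K N = blockStart j , ≤-trans (m≤n+m N (K + g)) (n≤blockStart j) , gap
  where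
  j = K + g + N
  g≤j : g ≤ j
  g≤j = ≤-trans (m≤n+m g K) (m≤m+n (K + g) N)
  K≤1+j : K ≤ suc j
  K≤1+j = ≤-trans (≤-trans (m≤m+n K g) (m≤m+n (K + g) N)) (n≤1+n j)
  gap : ∀ a → a ∈ₛ A → g ∣ a → a < blockStart j ⊎ K * blockStart j ≤ a
  gap a a∈A g∣a with ∈A⇒InA {a} a∈A
  ... | inj₁ full≤a with level a <? j
  ...   | yes level<j = inj₁ (below-level level<j)
  ...   | no  level≮j = inj₂ (≤-trans (*-monoˡ-≤ (blockStart j) K≤1+j)
                                       (≤-trans (fullStart-mono (≮⇒≥ level≮j)) full≤a))
  gap a a∈A g∣a | inj₂ level!∣ with level a <? g
  ...   | yes level<g = inj₁ (below-level (<-≤-trans level<g g≤j))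
  ...   | no  level≮g = ⊥-elim (progression-coprime 2≤g (≮⇒≥ level≮g) level!∣ g∣a)

mainTheorem2 : (h : ℕ) → h ≥ 2 →
    Σ NSet λ A →
      (0 ∈ₛ A)
      × IsAsymptoticBasisOfOrder h A
      × (∀ P → ¬ IsEssentiality A P)
mainTheorem2 h h≥2 =
  A , 0∈A , basisOfOrder-mono h≥2 A-basis , noEssentiality A (2 , s≤s z≤n , A-basis) noExtension
  where
  0∈A : 0 ∈ₛ A
  0∈A = InA⇒∈A {0} (inj₁ z≤n)
  noExtension : ∀ B p → B ⊆ₛ A → ¬ IsAsymptoticBasis B → ¬ IsAsymptoticBasis (insert p B)
  noExtension B p B⊆A = extension-not-basis p (sparse-⊆ B⊆A A-sparse)
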